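{- Let $n\geq 3$ and $3\leq k\leq 2^{n-1}$, and let $C_k$ be a cycle of length $k$ in $Q_n$. If $u$ and $v$ are adjacent vertices of $Q_n-V(C_k)$, then $|N_{Q_n}(\{u,v\})\cap V(C_k)|\leq k-1$.
   Context: $Q_n$ is the $n$-dimensional hypercube: its vertices are the binary strings of length $n$, two vertices being adjacent iff they differ in exactly one position. For a vertex set $S$, $N_{Q_n}(S)$ denotes the set of vertices of $Q_n$ adjacent to some vertex of $S$. -}

module Defs where

open import Data.Bool using (Bool; true; false; if_then_else_)
open import Data.Nat using (ℕ; zero; suc; _+_; _∸_)
open import Data.Nat.Properties using (_≟_)
open import Data.Vec using (Vec; []; _∷_)
open import Data.Fin using (Fin; toℕ)
open import Data.List using (List; length; filter)
open import Data.List using () renaming (allFin to allFinL)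
open import Data.Sum using (_⊎_)
open import Data.Product using (_×_)
open import Relation.Binary.PropositionalEquality using (_≡_; _≢_)
open import Relation.Nullary using (Dec)
open import Relation.Nullary.Decidable using (_⊎-dec_)
open import Function.Definitions using (Injective)

Vertex : ℕ → Set
Vertex n = Vec Bool n

hamming : ∀ {n} → Vertex n → Vertex n → ℕ
hamming []       []       = 0
hamming (x ∷ xs) (y ∷ ys) = (if Data.Bool._xor_ x y then 1 else 0) + hamming xs ys
  where import Data.Bool

Adj : ∀ {n} → Vertex n → Vertex n → Set
Adj x y = hamming x y ≡ 1

adj? : ∀ {n} (x y : Vertex n) → Dec (Adj x y)
adj? x y = hamming x y ≟ 1

record Cycle (n k : ℕ) : Set where
  field
    vtx      : Fin k → Vertex n
    distinct : Injective _≡_ _≡_ vtx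
    step     : ∀ (i j : Fin k) → toℕ j ≡ suc (toℕ i) → Adj (vtx i) (vtx j)
    close    : ∀ (i j : Fin k) → toℕ i ≡ k ∸ 1 → toℕ j ≡ 0 → Adj (vtx i) (vtx j)

open Cycle public

OnCycle : ∀ {n k} → Cycle n k → Vertex n → Set
OnCycle {k = k} C x = Data.Product.Σ (Fin k) (λ i → vtx C i ≡ x)
  where import Data.Product

-- |N_{Q_n}({u,v}) ∩ V(C)|: the number of cycle vertices adjacent to u or to v
-- (cycle vertices are distinct, so counting indices counts vertices).
nbrCount : ∀ {n k} → Cycle n k → Vertex n → Vertex n → ℕ
nbrCount {k = k} C u v =
  length (filter (λ i → adj? u (vtx C i) ⊎-dec adj? v (vtx C i)) (allFinL k))

-- Take three consecutive cycle vertices x ∼ y ∼ z and suppose each is adjacent to u or to v,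
-- say u ∼ y.  As Q_n has no triangles, u is adjacent to neither x nor z, so both are adjacent
-- to v.  Then v and y have the three distinct common neighbours u, x, z, whereas two distinct
-- vertices of Q_n have at most two common neighbours.  Hence some cycle vertex is adjacent to
-- neither u nor v.
module Submission where

open import Defs
open import Data.Nat using (ℕ; _≤_; _^_; _∸_)
open import Relation.Nullary using (¬_)

open import Data.Bool using (Bool; true; false)
open import Data.Nat using (suc; _<_; s≤s)
open import Data.Nat.Properties using (suc-injective; <⇒≤pred)
open import Data.Vec using ([]; _∷_)
open import Data.Fin using (Fin; #_)
open import Data.List using (allFin)
open import Data.List.Properties using (filter-notAll; length-tabulate)
open import Data.List.Membership.Propositional using (lose)
open import Data.List.Membership.Propositional.Properties using (∈-allFin)
open import Data.Sum using (_⊎_; inj₁; inj₂)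
import Data.Sum as Sum
open import Data.Product using (_,_)
open import Data.Empty using (⊥; ⊥-elim)
open import Function using (case_of_)
open import Relation.Nullary using (yes; no)
open import Relation.Nullary.Decidable using (_⊎-dec_)
open import Relation.Binary.PropositionalEquality using (_≡_; _≢_; refl; cong; sym; subst)

private
  variable
    n : ℕ
    b : Bool
    xs ys : Vertex n
    a c u v w x y z : Vertex n

infix 4 _∼_

data _∼_ : Vertex n → Vertex n → Set where
  true∼false : true  ∷ xs ∼ false ∷ xs
  false∼true : false ∷ xs ∼ true  ∷ xs
  there      : xs ∼ ys → b ∷ xs ∼ b ∷ ys

hamming≡0⇒≡ : hamming x y ≡ 0 → x ≡ y
hamming≡0⇒≡ {x = []}        {[]}        _  = refl
hamming≡0⇒≡ {x = true ∷ _}  {true ∷ _}  eq = cong (true ∷_) (hamming≡0⇒≡ eq)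
hamming≡0⇒≡ {x = false ∷ _} {false ∷ _} eq = cong (false ∷_) (hamming≡0⇒≡ eq)

Adj⇒∼ : Adj x y → x ∼ y
Adj⇒∼ {x = []} {[]} ()
Adj⇒∼ {x = true ∷ _}  {true ∷ _}  adj = there (Adj⇒∼ adj)
Adj⇒∼ {x = false ∷ _} {false ∷ _} adj = there (Adj⇒∼ adj)
Adj⇒∼ {x = true ∷ xs} {false ∷ ys} adj
  rewrite hamming≡0⇒≡ {x = xs} {ys} (suc-injective adj) = true∼false
Adj⇒∼ {x = false ∷ xs} {true ∷ ys} adj
  rewrite hamming≡0⇒≡ {x = xs} {ys} (suc-injective adj) = false∼true

∼-sym : x ∼ y → y ∼ x
∼-sym true∼false = false∼true
∼-sym false∼true = true∼false
∼-sym (there p)  = there (∼-sym p)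

∼-irrefl : ¬ (x ∼ x)
∼-irrefl (there p) = ∼-irrefl p

triangle-free : x ∼ y → y ∼ z → ¬ (x ∼ z)
triangle-free (there p)  (there q)  (there r)  = triangle-free p q r
triangle-free true∼false (there q)  true∼false = ∼-irrefl q
triangle-free false∼true (there q)  false∼true = ∼-irrefl q
triangle-free (there p)  true∼false true∼false = ∼-irrefl p
triangle-free (there p)  false∼true false∼true = ∼-irrefl p
triangle-free true∼false false∼true (there r)  = ∼-irrefl r
triangle-free false∼true true∼false (there r)  = ∼-irrefl r

-- A path a ∼ x ∼ b with a ≢ b flipping the first coordinate flips it either first or second, and
-- each choice determines x; so among three such paths two share their middle vertex.
K₂,₃-free : a ≢ c → x ≢ y → x ≢ z → y ≢ z →
            a ∼ x → x ∼ c → a ∼ y → y ∼ c → a ∼ z → z ∼ c → ⊥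
K₂,₃-free a≢c x≢y x≢z y≢z (there ax) (there xc) (there ay) (there yc) (there az) (there zc) =
  K₂,₃-free (λ e → a≢c (cong (_ ∷_) e)) (λ e → x≢y (cong (_ ∷_) e)) (λ e → x≢z (cong (_ ∷_) e))
            (λ e → y≢z (cong (_ ∷_) e)) ax xc ay yc az zc
K₂,₃-free a≢c _ _ _ true∼false false∼true _ _ _ _ = a≢c refl
K₂,₃-free a≢c _ _ _ false∼true true∼false _ _ _ _ = a≢c refl
K₂,₃-free a≢c _ _ _ _ _ true∼false false∼true _ _ = a≢c refl
K₂,₃-free a≢c _ _ _ _ _ false∼true true∼false _ _ = a≢c refl
K₂,₃-free a≢c _ _ _ _ _ _ _ true∼false false∼true = a≢c refl
K₂,₃-free a≢c _ _ _ _ _ _ _ false∼true true∼false = a≢c refl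
K₂,₃-free _ x≢y _ _ true∼false (there _) true∼false (there _) _ _ = x≢y refl
K₂,₃-free _ x≢y _ _ (there _) true∼false (there _) true∼false _ _ = x≢y refl
K₂,₃-free _ x≢y _ _ false∼true (there _) false∼true (there _) _ _ = x≢y refl
K₂,₃-free _ x≢y _ _ (there _) false∼true (there _) false∼true _ _ = x≢y refl
K₂,₃-free _ _ x≢z _ true∼false (there _) _ _ true∼false (there _) = x≢z refl
K₂,₃-free _ _ x≢z _ (there _) true∼false _ _ (there _) true∼false = x≢z refl
K₂,₃-free _ _ x≢z _ false∼true (there _) _ _ false∼true (there _) = x≢z refl
K₂,₃-free _ _ x≢z _ (there _) false∼true _ _ (there _) false∼true = x≢z refl
K₂,₃-free _ _ _ y≢z _ _ true∼false (there _) true∼false (there _) = y≢z refl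
K₂,₃-free _ _ _ y≢z _ _ (there _) true∼false (there _) true∼false = y≢z refl
K₂,₃-free _ _ _ y≢z _ _ false∼true (there _) false∼true (there _) = y≢z refl
K₂,₃-free _ _ _ y≢z _ _ (there _) false∼true (there _) false∼true = y≢z refl

Near : Vertex n → Vertex n → Vertex n → Set
Near u v w = u ∼ w ⊎ v ∼ w

private
  undominated-with-u∼y : u ∼ v → u ∼ y → x ∼ y → y ∼ z → x ≢ z → u ≢ x → u ≢ z → v ≢ y →
                         Near u v x → Near u v z → ⊥
  undominated-with-u∼y _   u∼y x∼y _   _   _   _   _   (inj₁ u∼x) _          = triangle-free u∼x x∼y u∼y
  undominated-with-u∼y _   u∼y _   y∼z _   _   _   _   (inj₂ _)   (inj₁ u∼z) = triangle-free u∼y y∼z u∼z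
  undominated-with-u∼y u∼v u∼y x∼y y∼z x≢z u≢x u≢z v≢y (inj₂ v∼x) (inj₂ v∼z) =
    K₂,₃-free v≢y u≢x u≢z x≢z (∼-sym u∼v) u∼y v∼x x∼y v∼z (∼-sym y∼z)

path-undominated-by-edge : u ∼ v → x ∼ y → y ∼ z → x ≢ z →
                           u ≢ x → u ≢ y → u ≢ z → v ≢ x → v ≢ y → v ≢ z →
                           Near u v x → Near u v y → Near u v z → ⊥
path-undominated-by-edge u∼v x∼y y∼z x≢z u≢x _ u≢z _ v≢y _ nx (inj₁ u∼y) nz =
  undominated-with-u∼y u∼v u∼y x∼y y∼z x≢z u≢x u≢z v≢y nx nz
path-undominated-by-edge u∼v x∼y y∼z x≢z _ u≢y _ v≢x _ v≢z nx (inj₂ v∼y) nz =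
  undominated-with-u∼y (∼-sym u∼v) v∼y x∼y y∼z x≢z v≢x v≢z u≢y (Sum.swap nx) (Sum.swap nz)

module _ {k} (C : Cycle n k) where

  nbrCount<k : (u v : Vertex n) (i : Fin k) → ¬ (Adj u (vtx C i) ⊎ Adj v (vtx C i)) → nbrCount C u v < k
  nbrCount<k u v i ¬near =
    subst (nbrCount C u v <_) (length-tabulate {n = k} (λ j → j))
          (filter-notAll (λ j → adj? u (vtx C j) ⊎-dec adj? v (vtx C j)) (allFin k) (lose (∈-allFin i) ¬near))

  ≢-vtx : ¬ OnCycle C w → (i : Fin k) → w ≢ vtx C i
  ≢-vtx w∉C i w≡c = w∉C (i , sym w≡c)

lemma16 : (n k : ℕ) → 3 ≤ n → 3 ≤ k → k ≤ 2 ^ (n ∸ 1) →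
    (C : Cycle n k) → (u v : Vertex n) →
    ¬ OnCycle C u → ¬ OnCycle C v → Adj u v →
    nbrCount C u v ≤ k ∸ 1
lemma16 n k _ (s≤s (s≤s (s≤s _))) _ C u v u∉C v∉C u-v
  with adj? u (vtx C (# 0)) ⊎-dec adj? v (vtx C (# 0))
     | adj? u (vtx C (# 1)) ⊎-dec adj? v (vtx C (# 1))
     | adj? u (vtx C (# 2)) ⊎-dec adj? v (vtx C (# 2))
... | no ¬near | _ | _ = <⇒≤pred (nbrCount<k C u v (# 0) ¬near)
... | _ | no ¬near | _ = <⇒≤pred (nbrCount<k C u v (# 1) ¬near)
... | _ | _ | no ¬near = <⇒≤pred (nbrCount<k C u v (# 2) ¬near)
... | yes near₀ | yes near₁ | yes near₂ = ⊥-elim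
  (path-undominated-by-edge (Adj⇒∼ u-v) (Adj⇒∼ (step C (# 0) (# 1) refl)) (Adj⇒∼ (step C (# 1) (# 2) refl))
     (λ c₀≡c₂ → case distinct C c₀≡c₂ of λ ())
     (≢-vtx C u∉C (# 0)) (≢-vtx C u∉C (# 1)) (≢-vtx C u∉C (# 2))
     (≢-vtx C v∉C (# 0)) (≢-vtx C v∉C (# 1)) (≢-vtx C v∉C (# 2))
     (toNear near₀) (toNear near₁) (toNear near₂))
  where
  toNear : Adj u w ⊎ Adj v w → Near u v w
  toNear = Sum.map Adj⇒∼ Adj⇒∼
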